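{- Let $\mathcal C$ be a class of graphs. Assume that for every finite set $\mathcal K'$ of connected graphs there are graphs $G$ and $H$ such that $G\in\mathcal C$, $H\notin\mathcal C$, and $\mathrm{emb}(F',G)=\mathrm{emb}(F',H)$ for all $F'\in\mathcal K'$. Then for every finite set $\mathcal K$ of graphs there are graphs $G$ and $H$ such that $G\in\mathcal C$, $H\notin\mathcal C$, and $\hom(F,G)=\hom(F,H)$ for all $F\in\mathcal K$; that is, there is no hom algorithm for $\mathcal C$.
   Context: Graphs are finite, simple, undirected, with non-empty vertex set; classes are closed under isomorphism. $\hom(F,G)$ is the number of homomorphisms from $F$ to $G$ and $\mathrm{emb}(F,G)$ the number of injective homomorphisms from $F$ to $G$. A class $\mathcal C$ has a hom algorithm if there are $k\ge1$, graphs $F_1,\dots,F_k$ and $X\subseteq\mathbb N^k$ such that for every graph $G$: $G\in\mathcal C\iff(\hom(F_1,G),\dots,\hom(F_k,G))\in X$. -}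

module Defs where

open import Data.Nat using (ℕ; zero; suc; _≤_)
open import Data.Fin using (Fin; zero; suc; _≟_)
open import Data.Bool using (Bool; true; false; _∧_; _∨_; not)
open import Data.List using (List; []; _∷_; map; concatMap; length; filterᵇ; allFin)
open import Data.Bool.ListAction using (all)
open import Data.List.Relation.Unary.All using (All)
open import Data.Vec using (Vec; toList)
import Data.Vec as Vec
open import Data.Product using (Σ; _×_; ∃-syntax)
open import Relation.Nullary using (¬_)
open import Relation.Nullary.Decidable using (⌊_⌋)
open import Relation.Binary.PropositionalEquality using (_≡_)
open import Function.Bundles using (_↔_; Inverse; _⇔_)

record Graph : Set where
  field
    V        : ℕ
    nonempty : 1 ≤ V
    adj      : Fin V → Fin V → Bool
    sym      : ∀ u v → adj u v ≡ adj v u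
    irrefl   : ∀ v → adj v v ≡ false
open Graph public

record _≅_ (G H : Graph) : Set where
  field
    bij      : Fin (V G) ↔ Fin (V H)
    preserve : ∀ u v → adj H (Inverse.to bij u) (Inverse.to bij v) ≡ adj G u v

IsoClosed : (Graph → Set) → Set
IsoClosed C = ∀ G H → G ≅ H → C G → C H

cons : ∀ {n m} → Fin m → (Fin n → Fin m) → Fin (suc n) → Fin m
cons k f zero    = k
cons k f (suc i) = f i

allFuns : (n m : ℕ) → List (Fin n → Fin m)
allFuns zero    m = (λ ()) ∷ []
allFuns (suc n) m = concatMap (λ k → map (cons k) (allFuns n m)) (allFin m)

isHom : (F G : Graph) → (Fin (V F) → Fin (V G)) → Bool
isHom F G f = all (λ u → all (λ v → not (adj F u v) ∨ adj G (f u) (f v)) (allFin (V F))) (allFin (V F))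

isInj : ∀ {n m} → (Fin n → Fin m) → Bool
isInj {n} f = all (λ u → all (λ v → ⌊ u ≟ v ⌋ ∨ not ⌊ f u ≟ f v ⌋) (allFin n)) (allFin n)

hom : Graph → Graph → ℕ
hom F G = length (filterᵇ (isHom F G) (allFuns (V F) (V G)))

emb : Graph → Graph → ℕ
emb F G = length (filterᵇ (λ f → isHom F G f ∧ isInj f) (allFuns (V F) (V G)))

data Reachable (G : Graph) : Fin (V G) → Fin (V G) → Set where
  here : ∀ {u} → Reachable G u u
  step : ∀ {u v w} → adj G u v ≡ true → Reachable G v w → Reachable G u w

Connected : Graph → Set
Connected G = ∀ u v → Reachable G u v

HasHomAlgorithm : (Graph → Set) → Set₁
HasHomAlgorithm C =
  Σ ℕ λ k → 1 ≤ k × Σ (Vec Graph k) λ Fs → Σ (Vec ℕ k → Set) λ X →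
    ∀ G → (C G ⇔ X (Vec.map (λ F → hom F G) Fs))

module Submission where

-- hom(F, G) is a function of the numbers emb(F′, G) for finitely many connected F′.
-- If the vertices of F split into two nonempty sets with no edge between them, hom(F, –)
-- is the product of the homomorphism counts of the two induced subgraphs; this reduces
-- everything to connected F. For connected F, count homomorphisms that separate a list R
-- of vertex pairs. For a non-edge ab, each such homomorphism either also separates a and b
-- or factors through the contraction F/ab, which is connected and smaller. Once R contains
-- every non-edge, the count is emb(F, –), or 0 if R contains a pair (u, u).
-- So the graphs G ∈ C, H ∉ C given for the finitely many connected F′ that arise agree on
-- hom(F, –) for every F ∈ K, and no vector of hom counts separates C from its complement.

open import Algebra.Properties.Semiring.Sum as ∑ using ()
open import Data.Bool using (Bool; true; false; _∧_; _∨_; not)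
open import Data.Bool.ListAction using (all; any)
open import Data.Bool.Properties using (T-≡; ¬-not; ∧-zeroʳ; ∧-identityʳ)
open import Data.Fin using (Fin; zero; suc; _≟_; punchIn; punchOut; fromℕ<)
open import Data.Fin.Properties using (any?; punchIn-punchOut; nonZeroIndex)
open import Data.Fin.Subset using (Subset; inside; outside; ∣_∣; ∁; ⁅_⁆; _⊆_; _⊂_) renaming (_∈_ to _∈ₛ_)
open import Data.Fin.Subset.Properties
  using (_∈?_; x∈∁p⇒x∉p; x∉p⇒x∈∁p; x∉∁p⇒x∈p; x∈⁅x⁆; x∈⁅y⁆⇒x≡y; ∣⁅x⁆∣≡1; ∣p∣≤n; ∣∁p∣≡n∸∣p∣;
         p⊂q⇒∣p∣<∣q∣; nonempty?)
open import Data.List using (List; []; _∷_; _++_; map; concatMap; length; filterᵇ; allFin; tabulate; cartesianProduct)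
open import Data.List.Membership.Propositional using (_∈_; lose)
open import Data.List.Membership.Propositional.Properties using (∈-allFin; ∈-cartesianProduct⁺)
open import Data.List.Properties using (map-++; map-∘)
open import Data.List.Relation.Unary.All as All using (All; []; _∷_)
open import Data.List.Relation.Unary.All.Properties using (all⁺; all⁻; ++⁺; ++⁻ˡ; ++⁻ʳ)
open import Data.List.Relation.Unary.Any as Any using (Any; here; there; satisfied)
open import Data.List.Relation.Unary.Any.Properties using (any⁺; any⁻)
open import Data.Nat using (ℕ; zero; suc; _+_; _*_; _≤_; _<_; z≤n; s≤s; >-nonZero⁻¹)
import Data.Nat.ListAction as List
open import Data.Nat.ListAction.Properties using (sum-++)
open import Data.Nat.Properties
  using (+-*-semiring; +-identityʳ; *-identityˡ; *-zeroʳ; ≤-refl; ≤-trans; ≤-pred; <⇒≱; m<m+n; m<n+m; m+[n∸m]≡n)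
import Data.Product as Product
open import Data.Product using (_×_; _,_; proj₁; proj₂; ∃-syntax)
open import Data.Sum using (_⊎_; inj₁; inj₂)
open import Data.Vec as Vec using (Vec; here; there; _∷_; [])
open import Data.Vec.Properties using (lookup∘tabulate; []=⇒lookup; lookup⇒[]=)
open import Defs hiding (sym)
open import Function using (_∘_; id; case_of_; Equivalence)
open import Relation.Binary.PropositionalEquality
open import Relation.Nullary.Decidable using (⌊_⌋; does; yes; no; _×-dec_; ¬?; dec-true)
open import Relation.Nullary.Negation using (¬_; contradiction)

open ∑ +-*-semiring
  using (sum-syntax; sum-cong-≗; sum-replicate-zero; ∑-distrib-+; ∑-comm; *-distribˡ-sum; *-distribʳ-sum)
open Equivalence using (to; from)

bit : Bool → ℕ
bit true  = 1
bit false = 0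

bit-∧ : ∀ x y → bit (x ∧ y) ≡ bit x * bit y
bit-∧ true  y = sym (*-identityˡ (bit y))
bit-∧ false y = refl

bit-split : ∀ x e y → bit (x ∧ y) ≡ bit (x ∧ (not e ∧ y)) + bit e * bit (x ∧ y)
bit-split false e     y     = sym (*-zeroʳ (bit e))
bit-split true  false y     = sym (+-identityʳ (bit y))
bit-split true  true  false = refl
bit-split true  true  true  = refl

∧-true⁻ : ∀ {x y} → x ∧ y ≡ true → x ≡ true × y ≡ true
∧-true⁻ {true} {true} _ = refl , refl

∧-true⁺ : ∀ {x y} → x ≡ true → y ≡ true → x ∧ y ≡ true
∧-true⁺ refl refl = refl

∨-true⁻ : ∀ {x y} → x ∨ y ≡ true → x ≡ true ⊎ y ≡ true
∨-true⁻ {true}  _ = inj₁ refl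
∨-true⁻ {false} e = inj₂ e

∨-trueˡ : ∀ {x} y → x ≡ true → x ∨ y ≡ true
∨-trueˡ y refl = refl

∨-trueʳ : ∀ x {y} → y ≡ true → x ∨ y ≡ true
∨-trueʳ true  _ = refl
∨-trueʳ false e = e

≡true-ext : ∀ {x y} → (x ≡ true → y ≡ true) → (y ≡ true → x ≡ true) → x ≡ y
≡true-ext {true}  {true}  _ _ = refl
≡true-ext {true}  {false} f _ = sym (f refl)
≡true-ext {false} {true}  _ g = g refl
≡true-ext {false} {false} _ _ = refl

all-true⁻ : ∀ {A : Set} (p : A → Bool) xs → all p xs ≡ true → ∀ {x} → x ∈ xs → p x ≡ true
all-true⁻ p xs e x∈ = to T-≡ (All.lookup (all⁺ p xs (from T-≡ e)) x∈)

all-true⁺ : ∀ {A : Set} (p : A → Bool) xs → (∀ {x} → x ∈ xs → p x ≡ true) → all p xs ≡ true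
all-true⁺ p xs h = to T-≡ (all⁻ p (All.tabulate (from T-≡ ∘ h)))

all-allFin⁻ : ∀ {n} (p : Fin n → Bool) → all p (allFin n) ≡ true → ∀ i → p i ≡ true
all-allFin⁻ {n} p e i = all-true⁻ p (allFin n) e (∈-allFin i)

all-allFin⁺ : ∀ {n} (p : Fin n → Bool) → (∀ i → p i ≡ true) → all p (allFin n) ≡ true
all-allFin⁺ {n} p h = all-true⁺ p (allFin n) (λ {i} _ → h i)

any-allFin⁻ : ∀ {n} (p : Fin n → Bool) → any p (allFin n) ≡ true → ∃[ i ] p i ≡ true
any-allFin⁻ {n} p = Product.map₂ (to T-≡) ∘ satisfied ∘ any⁻ p (allFin n) ∘ from T-≡

any-allFin⁺ : ∀ {n} (p : Fin n → Bool) i → p i ≡ true → any p (allFin n) ≡ true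
any-allFin⁺ p i e = to T-≡ (any⁺ p (lose (∈-allFin i) (from T-≡ e)))

≟-true⁻ : ∀ {n} {x y : Fin n} → does (x ≟ y) ≡ true → x ≡ y
≟-true⁻ {x = x} {y} e with x ≟ y
... | yes x≡y = x≡y

-- Sums over all maps Fin n → Fin m

sumMaps : ∀ n m → ((Fin n → Fin m) → ℕ) → ℕ
sumMaps zero    m w = w (λ ())
sumMaps (suc n) m w = ∑[ k < m ] sumMaps n m (λ h → w (cons k h))

sumMaps-cong : ∀ n m {w₁ w₂ : (Fin n → Fin m) → ℕ} → (∀ f → w₁ f ≡ w₂ f) → sumMaps n m w₁ ≡ sumMaps n m w₂
sumMaps-cong zero    m eq = eq _
sumMaps-cong (suc n) m eq = sum-cong-≗ {m} (λ k → sumMaps-cong n m (λ h → eq (cons k h)))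

sumMaps-zero : ∀ n m → sumMaps n m (λ _ → 0) ≡ 0
sumMaps-zero zero    m = refl
sumMaps-zero (suc n) m = trans (sum-cong-≗ {m} (λ _ → sumMaps-zero n m)) (sum-replicate-zero m)

sumMaps-distrib-+ : ∀ n m (w₁ w₂ : (Fin n → Fin m) → ℕ) →
  sumMaps n m (λ f → w₁ f + w₂ f) ≡ sumMaps n m w₁ + sumMaps n m w₂
sumMaps-distrib-+ zero    m w₁ w₂ = refl
sumMaps-distrib-+ (suc n) m w₁ w₂ =
  trans (sum-cong-≗ {m} (λ k → sumMaps-distrib-+ n m _ _)) (∑-distrib-+ {m} _ _)

∑-sumMaps-comm : ∀ n m p (w : Fin p → (Fin n → Fin m) → ℕ) →
  ∑[ k < p ] sumMaps n m (w k) ≡ sumMaps n m (λ f → ∑[ k < p ] w k f)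
∑-sumMaps-comm zero    m p w = refl
∑-sumMaps-comm (suc n) m p w =
  trans (∑-comm {p} {m} _) (sum-cong-≗ {m} (λ j → ∑-sumMaps-comm n m p (λ k h → w k (cons j h))))

-- does rather than ⌊_⌋: only the former reduces on suc x ≟ suc y.
∑-indicator : ∀ m (c : Fin m) (q : Fin m → ℕ) → ∑[ k < m ] (bit (does (k ≟ c)) * q k) ≡ q c
∑-indicator (suc m) zero    q = trans (cong₂ _+_ (*-identityˡ (q zero)) (sum-replicate-zero m)) (+-identityʳ (q zero))
∑-indicator (suc m) (suc c) q = ∑-indicator m c (q ∘ suc)

-- Data.Vec.Functional.insertAt, rebuilt from cons so that it unfolds in step with sumMaps.
insert : ∀ {n m} → Fin (suc n) → Fin m → (Fin n → Fin m) → Fin (suc n) → Fin m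
insert zero          k h = cons k h
insert {suc n} (suc j) k h = cons (h zero) (insert j k (h ∘ suc))

insert-at : ∀ {n m} (j : Fin (suc n)) (k : Fin m) h → insert j k h j ≡ k
insert-at zero          k h = refl
insert-at {suc n} (suc j) k h = insert-at j k (h ∘ suc)

insert-punchIn : ∀ {n m} (j : Fin (suc n)) (k : Fin m) h x → insert j k h (punchIn j x) ≡ h x
insert-punchIn zero          k h x       = refl
insert-punchIn {suc n} (suc j) k h zero    = refl
insert-punchIn {suc n} (suc j) k h (suc x) = insert-punchIn j k (h ∘ suc) x

insert-∘ : ∀ {n m m′} (j : Fin (suc n)) (k : Fin m) h (g : Fin m → Fin m′) u →
  insert j (g k) (g ∘ h) u ≡ g (insert j k h u)
insert-∘ zero          k h g zero    = refl
insert-∘ zero          k h g (suc u) = refl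
insert-∘ {suc n} (suc j) k h g zero    = refl
insert-∘ {suc n} (suc j) k h g (suc u) = insert-∘ j k (h ∘ suc) g u

sumMaps-insert : ∀ n m (j : Fin (suc n)) (w : (Fin (suc n) → Fin m) → ℕ) →
  sumMaps (suc n) m w ≡ ∑[ k < m ] sumMaps n m (λ h → w (insert j k h))
sumMaps-insert n       m zero    w = refl
sumMaps-insert (suc n) m (suc j) w =
  trans (sum-cong-≗ {m} (λ a → sumMaps-insert n m j (λ h → w (cons a h)))) (∑-comm {m} {m} _)

-- A map identifying a with punchIn a b′ is a map h on Fin n with the value h b′ copied to position a.
sumMaps-identify : ∀ n m (a : Fin (suc n)) (b′ : Fin n) (w : (Fin (suc n) → Fin m) → ℕ) →
  sumMaps (suc n) m (λ f → bit (does (f a ≟ f (punchIn a b′))) * w f) ≡ sumMaps n m (λ h → w (insert a (h b′) h))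
sumMaps-identify n m a b′ w = begin
  sumMaps (suc n) m (λ f → bit (does (f a ≟ f (punchIn a b′))) * w f)
    ≡⟨ sumMaps-insert n m a (λ f → bit (does (f a ≟ f (punchIn a b′))) * w f) ⟩
  ∑[ k < m ] sumMaps n m (λ h → bit (does (insert a k h a ≟ insert a k h (punchIn a b′))) * w (insert a k h))
    ≡⟨ sum-cong-≗ {m} (λ k → sumMaps-cong n m (λ h →
         cong₂ (λ x y → bit (does (x ≟ y)) * w (insert a k h)) (insert-at a k h) (insert-punchIn a k h b′))) ⟩
  ∑[ k < m ] sumMaps n m (λ h → bit (does (k ≟ h b′)) * w (insert a k h))
    ≡⟨ ∑-sumMaps-comm n m m _ ⟩
  sumMaps n m (λ h → ∑[ k < m ] (bit (does (k ≟ h b′)) * w (insert a k h)))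
    ≡⟨ sumMaps-cong n m (λ h → ∑-indicator m (h b′) (λ k → w (insert a k h))) ⟩
  sumMaps n m (λ h → w (insert a (h b′) h)) ∎
  where open ≡-Reasoning

restrict : ∀ {n m} (p : Subset n) → (Fin n → Fin m) → Fin ∣ p ∣ → Fin m
restrict []            f = f
restrict (inside  ∷ p) f = cons (f zero) (restrict p (f ∘ suc))
restrict (outside ∷ p) f = restrict p (f ∘ suc)

restrict-∘ : ∀ {n m m′} (p : Subset n) (g : Fin m → Fin m′) (f : Fin n → Fin m) i →
  restrict p (g ∘ f) i ≡ g (restrict p f i)
restrict-∘ []            g f i       = refl
restrict-∘ (inside  ∷ p) g f zero    = refl
restrict-∘ (inside  ∷ p) g f (suc i) = restrict-∘ p g (f ∘ suc) i
restrict-∘ (outside ∷ p) g f i       = restrict-∘ p g (f ∘ suc) i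

ι : ∀ {n} (p : Subset n) → Fin ∣ p ∣ → Fin n
ι p = restrict p id

restrict-ι : ∀ {n m} (p : Subset n) (f : Fin n → Fin m) i → restrict p f i ≡ f (ι p i)
restrict-ι p f = restrict-∘ p f id

ι-surjective : ∀ {n} {p : Subset n} {u} → u ∈ₛ p → ∃[ i ] ι p i ≡ u
ι-surjective {p = inside ∷ p} here = zero , refl
ι-surjective {p = inside ∷ p} (there u∈p) with i , ιi≡u ← ι-surjective u∈p =
  suc i , trans (restrict-∘ p suc id i) (cong suc ιi≡u)
ι-surjective {p = outside ∷ p} (there u∈p) with i , ιi≡u ← ι-surjective u∈p =
  i , trans (restrict-∘ p suc id i) (cong suc ιi≡u)

sumMaps-restrict-* : ∀ n m (p : Subset n) (w₁ : (Fin ∣ p ∣ → Fin m) → ℕ) (w₂ : (Fin ∣ ∁ p ∣ → Fin m) → ℕ) →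
  sumMaps n m (λ f → w₁ (restrict p f) * w₂ (restrict (∁ p) f)) ≡ sumMaps (∣ p ∣) m w₁ * sumMaps (∣ ∁ p ∣) m w₂
sumMaps-restrict-* zero    m []            w₁ w₂ = refl
sumMaps-restrict-* (suc n) m (inside  ∷ p) w₁ w₂ =
  trans (sum-cong-≗ {m} (λ k → sumMaps-restrict-* n m p (w₁ ∘ cons k) w₂))
        (sym (*-distribʳ-sum {m} (sumMaps (∣ ∁ p ∣) m w₂) _))
sumMaps-restrict-* (suc n) m (outside ∷ p) w₁ w₂ =
  trans (sum-cong-≗ {m} (λ k → sumMaps-restrict-* n m p w₁ (w₂ ∘ cons k)))
        (sym (*-distribˡ-sum {m} (sumMaps (∣ p ∣) m w₁) _))

-- Homomorphism counts

length-filterᵇ : ∀ {A : Set} (p : A → Bool) xs → length (filterᵇ p xs) ≡ List.sum (map (bit ∘ p) xs)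
length-filterᵇ p []       = refl
length-filterᵇ p (x ∷ xs) with p x
... | true  = cong suc (length-filterᵇ p xs)
... | false = length-filterᵇ p xs

sum-map-concatMap : ∀ {A B : Set} (w : B → ℕ) (g : A → List B) xs →
  List.sum (map w (concatMap g xs)) ≡ List.sum (map (λ x → List.sum (map w (g x))) xs)
sum-map-concatMap w g []       = refl
sum-map-concatMap w g (x ∷ xs) = begin
  List.sum (map w (g x ++ concatMap g xs))                        ≡⟨ cong List.sum (map-++ w (g x) _) ⟩
  List.sum (map w (g x) ++ map w (concatMap g xs))                ≡⟨ sum-++ (map w (g x)) _ ⟩
  List.sum (map w (g x)) + List.sum (map w (concatMap g xs))      ≡⟨ cong (_ +_) (sum-map-concatMap w g xs) ⟩
  List.sum (map w (g x)) + List.sum (map (λ x → List.sum (map w (g x))) xs) ∎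
  where open ≡-Reasoning

sum-map-tabulate : ∀ {A : Set} m (g : Fin m → A) (w : A → ℕ) → List.sum (map w (tabulate g)) ≡ ∑[ k < m ] w (g k)
sum-map-tabulate zero    g w = refl
sum-map-tabulate (suc m) g w = cong (w (g zero) +_) (sum-map-tabulate m (g ∘ suc) w)

sum-map-allFuns : ∀ n m (w : (Fin n → Fin m) → ℕ) → List.sum (map w (allFuns n m)) ≡ sumMaps n m w
sum-map-allFuns zero    m w = +-identityʳ _
sum-map-allFuns (suc n) m w = begin
  List.sum (map w (concatMap (λ k → map (cons k) (allFuns n m)) (allFin m)))
    ≡⟨ sum-map-concatMap w _ (allFin m) ⟩
  List.sum (map (λ k → List.sum (map w (map (cons k) (allFuns n m)))) (allFin m))
    ≡⟨ sum-map-tabulate m (λ k → k) _ ⟩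
  ∑[ k < m ] List.sum (map w (map (cons k) (allFuns n m)))
    ≡⟨ sum-cong-≗ {m} (λ k → trans (cong List.sum (sym (map-∘ (allFuns n m)))) (sum-map-allFuns n m (w ∘ cons k))) ⟩
  sumMaps (suc n) m w ∎
  where open ≡-Reasoning

count-allFuns : ∀ n m (p : (Fin n → Fin m) → Bool) → length (filterᵇ p (allFuns n m)) ≡ sumMaps n m (bit ∘ p)
count-allFuns n m p = trans (length-filterᵇ p (allFuns n m)) (sum-map-allFuns n m (bit ∘ p))

IsHom : (F G : Graph) → (Fin (V F) → Fin (V G)) → Set
IsHom F G f = ∀ u v → adj F u v ≡ true → adj G (f u) (f v) ≡ true

isHom⇒IsHom : ∀ F G f → isHom F G f ≡ true → IsHom F G f
isHom⇒IsHom F G f e u v a with all-allFin⁻ _ (all-allFin⁻ _ e u) v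
... | t rewrite a = t

IsHom⇒isHom : ∀ F G f → IsHom F G f → isHom F G f ≡ true
IsHom⇒isHom F G f h = all-allFin⁺ _ (λ u → all-allFin⁺ _ (λ v → edge u v))
  where
  edge : ∀ u v → not (adj F u v) ∨ adj G (f u) (f v) ≡ true
  edge u v with adj F u v in a
  ... | true  = h u v a
  ... | false = refl

IsHom-cong : ∀ F G {f g} → (∀ u → f u ≡ g u) → IsHom F G f → IsHom F G g
IsHom-cong F G f≗g h u v a = subst₂ (λ x y → adj G x y ≡ true) (f≗g u) (f≗g v) (h u v a)

isHom-cong : ∀ F G {f g} → (∀ u → f u ≡ g u) → isHom F G f ≡ isHom F G g
isHom-cong F G {f} {g} f≗g = ≡true-ext
  (IsHom⇒isHom F G g ∘ IsHom-cong F G f≗g ∘ isHom⇒IsHom F G f)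
  (IsHom⇒isHom F G f ∘ IsHom-cong F G (sym ∘ f≗g) ∘ isHom⇒IsHom F G g)

isInj⇒injective : ∀ {n m} {f : Fin n → Fin m} → isInj f ≡ true → ∀ u v → f u ≡ f v → u ≡ v
isInj⇒injective {f = f} e u v fu≡fv with u ≟ v | all-allFin⁻ _ (all-allFin⁻ _ e u) v
... | yes u≡v | _ = u≡v
... | no _    | t with f u ≟ f v
...   | no fu≢fv = contradiction fu≡fv fu≢fv

injective⇒isInj : ∀ {n m} {f : Fin n → Fin m} → (∀ u v → f u ≡ f v → u ≡ v) → isInj f ≡ true
injective⇒isInj {f = f} inj = all-allFin⁺ _ (λ u → all-allFin⁺ _ (λ v → pair u v))
  where
  pair : ∀ u v → ⌊ u ≟ v ⌋ ∨ not ⌊ f u ≟ f v ⌋ ≡ true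
  pair u v with u ≟ v | f u ≟ f v
  ... | yes _   | _          = refl
  ... | no u≢v  | yes fu≡fv = contradiction (inj u v fu≡fv) u≢v
  ... | no _    | no _      = refl

hom≡sumMaps : ∀ F G → hom F G ≡ sumMaps (V F) (V G) (bit ∘ isHom F G)
hom≡sumMaps F G = count-allFuns (V F) (V G) (isHom F G)

-- Splitting off a union of components

induced : (F : Graph) (p : Subset (V F)) → 1 ≤ ∣ p ∣ → Graph
induced F p ne = record
  { V        = ∣ p ∣
  ; nonempty = ne
  ; adj      = λ i j → adj F (ι p i) (ι p j)
  ; sym      = λ i j → Graph.sym F (ι p i) (ι p j)
  ; irrefl   = λ i → irrefl F (ι p i)
  }

IsHom-restrict : ∀ F G f p ne → IsHom F G f → IsHom (induced F p ne) G (restrict p f)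
IsHom-restrict F G f p ne h i j a =
  subst₂ (λ x y → adj G x y ≡ true) (sym (restrict-ι p f i)) (sym (restrict-ι p f j)) (h _ _ a)

IsHom-induced-edge : ∀ F G f p ne → IsHom (induced F p ne) G (restrict p f) →
  ∀ {u v} → u ∈ₛ p → v ∈ₛ p → adj F u v ≡ true → adj G (f u) (f v) ≡ true
IsHom-induced-edge F G f p ne h u∈p v∈p a
  with i , refl ← ι-surjective u∈p | j , refl ← ι-surjective v∈p =
  subst₂ (λ x y → adj G x y ≡ true) (restrict-ι p f i) (restrict-ι p f j) (h i j a)

Closed : (F : Graph) → Subset (V F) → Set
Closed F p = ∀ {u v} → adj F u v ≡ true → u ∈ₛ p → v ∈ₛ p

closed-∁ : ∀ {F p} → Closed F p → Closed F (∁ p)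
closed-∁ {F} {p} closed {u} {v} a u∈∁p with v ∈? p
... | yes v∈p = contradiction (closed (trans (Graph.sym F v u) a) v∈p) (x∈∁p⇒x∉p u∈∁p)
... | no  v∉p = x∉p⇒x∈∁p v∉p

module _ {F : Graph} {p : Subset (V F)} (closed : Closed F p) (ne : 1 ≤ ∣ p ∣) (ne′ : 1 ≤ ∣ ∁ p ∣) where

  private
    Fₚ F∁ₚ : Graph
    Fₚ  = induced F p ne
    F∁ₚ = induced F (∁ p) ne′

  isHom-split : ∀ G f → isHom F G f ≡ isHom Fₚ G (restrict p f) ∧ isHom F∁ₚ G (restrict (∁ p) f)
  isHom-split G f = ≡true-ext
    (λ e → ∧-true⁺ (IsHom⇒isHom Fₚ G (restrict p f) (IsHom-restrict F G f p ne (isHom⇒IsHom F G f e)))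
                    (IsHom⇒isHom F∁ₚ G (restrict (∁ p) f) (IsHom-restrict F G f (∁ p) ne′ (isHom⇒IsHom F G f e))))
    (λ e → IsHom⇒isHom F G f (edge (∧-true⁻ {isHom Fₚ G (restrict p f)} e)))
    where
    edge : isHom Fₚ G (restrict p f) ≡ true × isHom F∁ₚ G (restrict (∁ p) f) ≡ true → IsHom F G f
    edge (e , e′) u v a with u ∈? p
    ... | yes u∈p = IsHom-induced-edge F G f p ne (isHom⇒IsHom Fₚ G (restrict p f) e) u∈p (closed a u∈p) a
    ... | no  u∉p = IsHom-induced-edge F G f (∁ p) ne′ (isHom⇒IsHom F∁ₚ G (restrict (∁ p) f) e′)
                      (x∉p⇒x∈∁p u∉p) (closed-∁ {F} {p} closed a (x∉p⇒x∈∁p u∉p)) a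

  hom-split : ∀ G → hom F G ≡ hom Fₚ G * hom F∁ₚ G
  hom-split G = begin
    hom F G
      ≡⟨ hom≡sumMaps F G ⟩
    sumMaps (V F) (V G) (bit ∘ isHom F G)
      ≡⟨ sumMaps-cong (V F) (V G) (λ f → trans (cong bit (isHom-split G f)) (bit-∧ (isHom Fₚ G (restrict p f)) _)) ⟩
    sumMaps (V F) (V G) (λ f → bit (isHom Fₚ G (restrict p f)) * bit (isHom F∁ₚ G (restrict (∁ p) f)))
      ≡⟨ sumMaps-restrict-* (V F) (V G) p _ _ ⟩
    sumMaps (∣ p ∣) (V G) (bit ∘ isHom Fₚ G) * sumMaps (∣ ∁ p ∣) (V G) (bit ∘ isHom F∁ₚ G)
      ≡⟨ sym (cong₂ _*_ (hom≡sumMaps Fₚ G) (hom≡sumMaps F∁ₚ G)) ⟩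
    hom Fₚ G * hom F∁ₚ G ∎
    where open ≡-Reasoning

reachable-snoc : ∀ {G u w v} → Reachable G u w → adj G w v ≡ true → Reachable G u v
reachable-snoc here         a = step a here
reachable-snoc (step a′ r)  a = step a′ (reachable-snoc r a)

reachable-trans : ∀ {G u w v} → Reachable G u w → Reachable G w v → Reachable G u v
reachable-trans here        r = r
reachable-trans (step a q)  r = step a (reachable-trans q r)

reachable-sym : ∀ {G u v} → Reachable G u v → Reachable G v u
reachable-sym             here                 = here
reachable-sym {G} (step {u} {w} a r) = reachable-snoc (reachable-sym r) (trans (Graph.sym G w u) a)

∈-tabulate⁻ : ∀ {n} {f : Fin n → Bool} {v} → v ∈ₛ Vec.tabulate f → f v ≡ true
∈-tabulate⁻ {f = f} {v} v∈ = trans (sym (lookup∘tabulate f v)) ([]=⇒lookup v∈)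

∈-tabulate⁺ : ∀ {n} {f : Fin n → Bool} {v} → f v ≡ true → v ∈ₛ Vec.tabulate f
∈-tabulate⁺ {f = f} {v} e = lookup⇒[]= v _ (trans (lookup∘tabulate f v) e)

∈⇒1≤∣∣ : ∀ {n} {p : Subset n} {u} → u ∈ₛ p → 1 ≤ ∣ p ∣
∈⇒1≤∣∣ {p = inside  ∷ p} _           = s≤s z≤n
∈⇒1≤∣∣ {p = outside ∷ p} (there u∈p) = ∈⇒1≤∣∣ u∈p

∣p∣+∣∁p∣≡n : ∀ {n} (p : Subset n) → ∣ p ∣ + ∣ ∁ p ∣ ≡ n
∣p∣+∣∁p∣≡n p = trans (cong (∣ p ∣ +_) (∣∁p∣≡n∸∣p∣ p)) (m+[n∸m]≡n (∣p∣≤n p))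

module Component (F : Graph) (x : Fin (V F)) where

  expand : Subset (V F) → Subset (V F)
  expand p = Vec.tabulate (λ v → Vec.lookup p v ∨ any (λ u → Vec.lookup p u ∧ adj F u v) (allFin (V F)))

  ⊆-expand : ∀ p → p ⊆ expand p
  ⊆-expand p v∈p = ∈-tabulate⁺ (∨-trueˡ _ ([]=⇒lookup v∈p))

  expand-adj : ∀ {p u v} → u ∈ₛ p → adj F u v ≡ true → v ∈ₛ expand p
  expand-adj {p} {u} u∈p a = ∈-tabulate⁺ (∨-trueʳ _ (any-allFin⁺ _ u (∧-true⁺ ([]=⇒lookup u∈p) a)))

  expand⁻ : ∀ {p v} → v ∈ₛ expand p → v ∈ₛ p ⊎ ∃[ u ] (u ∈ₛ p × adj F u v ≡ true)
  expand⁻ {p} {v} v∈ with ∨-true⁻ {Vec.lookup p v} (∈-tabulate⁻ v∈)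
  ... | inj₁ e = inj₁ (lookup⇒[]= v p e)
  ... | inj₂ e with u , e′ ← any-allFin⁻ _ e with l , a ← ∧-true⁻ {Vec.lookup p u} e′ =
    inj₂ (u , lookup⇒[]= u p l , a)

  closed-expand : ∀ {p} → Closed F p → Closed F (expand p)
  closed-expand {p} closed a u∈ with expand⁻ u∈
  ... | inj₁ u∈p             = ⊆-expand p (closed a u∈p)
  ... | inj₂ (w , w∈p , a′)  = ⊆-expand p (closed a (closed a′ w∈p))

  closed-or-expands : ∀ p → Closed F p ⊎ p ⊂ expand p
  closed-or-expands p with any? (λ v → v ∈? expand p ×-dec ¬? (v ∈? p))
  ... | yes (v , v∈ , v∉p) = inj₂ (⊆-expand p , v , v∈ , v∉p)
  ... | no ∄new = inj₁ closed
    where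
    closed : Closed F p
    closed {u} {v} a u∈p with v ∈? p
    ... | yes v∈p = v∈p
    ... | no  v∉p = contradiction (v , expand-adj u∈p a , v∉p) ∄new

  grow : ℕ → Subset (V F)
  grow zero    = ⁅ x ⁆
  grow (suc t) = expand (grow t)

  x∈grow : ∀ t → x ∈ₛ grow t
  x∈grow zero    = x∈⁅x⁆ x
  x∈grow (suc t) = ⊆-expand (grow t) (x∈grow t)

  grow-reachable : ∀ t {v} → v ∈ₛ grow t → Reachable F x v
  grow-reachable zero v∈ with refl ← x∈⁅y⁆⇒x≡y x v∈ = here
  grow-reachable (suc t) v∈ with expand⁻ v∈
  ... | inj₁ v∈g            = grow-reachable t v∈g
  ... | inj₂ (u , u∈g , a)  = reachable-snoc (grow-reachable t u∈g) a

  grow-closed-or-large : ∀ t → Closed F (grow t) ⊎ t < ∣ grow t ∣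
  grow-closed-or-large zero = inj₂ (subst (0 <_) (sym (∣⁅x⁆∣≡1 x)) (s≤s z≤n))
  grow-closed-or-large (suc t) with grow-closed-or-large t | closed-or-expands (grow t)
  ... | inj₁ closed | _            = inj₁ (closed-expand closed)
  ... | inj₂ _      | inj₁ closed  = inj₁ (closed-expand closed)
  ... | inj₂ t<∣g∣  | inj₂ g⊂g′    = inj₂ (≤-trans (s≤s t<∣g∣) (p⊂q⇒∣p∣<∣q∣ g⊂g′))

  component : Subset (V F)
  component = grow (V F)

  -- grow t has more than t vertices until it is closed, and no subset has more than V F.
  component-closed : Closed F component
  component-closed with grow-closed-or-large (V F)
  ... | inj₁ closed = closed
  ... | inj₂ n<∣c∣  = contradiction (∣p∣≤n component) (<⇒≱ n<∣c∣)

  connected-or-splits : Connected F ⊎ ∃[ p ] (Closed F p × 1 ≤ ∣ p ∣ × 1 ≤ ∣ ∁ p ∣)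
  connected-or-splits with nonempty? (∁ component)
  ... | yes (v , v∈∁c) = inj₂ (component , component-closed , ∈⇒1≤∣∣ (x∈grow (V F)) , ∈⇒1≤∣∣ v∈∁c)
  ... | no ∁c-empty   = inj₁ λ u v → reachable-trans (reachable-sym (reach u)) (reach v)
    where
    reach : ∀ v → Reachable F x v
    reach v = grow-reachable (V F) (x∉∁p⇒x∈p (λ v∈∁c → ∁c-empty (v , v∈∁c)))

connected-or-splits : ∀ F → Connected F ⊎ ∃[ p ] (Closed F p × 1 ≤ ∣ p ∣ × 1 ≤ ∣ ∁ p ∣)
connected-or-splits F = Component.connected-or-splits F (fromℕ< (nonempty F))

-- Deletion–contraction

separates : ∀ {n m} → List (Fin n × Fin n) → (Fin n → Fin m) → Bool
separates R f = all (λ (u , v) → not (does (f u ≟ f v))) R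

separates-cong : ∀ {n m} R {f g : Fin n → Fin m} → (∀ u → f u ≡ g u) → separates R f ≡ separates R g
separates-cong []            f≗g = refl
separates-cong ((u , v) ∷ R) f≗g =
  cong₂ _∧_ (cong₂ (λ x y → not (does (x ≟ y))) (f≗g u) (f≗g v)) (separates-cong R f≗g)

separates-∘ : ∀ {n n′ m} R (g : Fin n → Fin n′) (h : Fin n′ → Fin m) →
  separates R (h ∘ g) ≡ separates (map (Product.map g g) R) h
separates-∘ []      g h = refl
separates-∘ (_ ∷ R) g h = cong (_ ∧_) (separates-∘ R g h)

HasLoop : ∀ {n} → List (Fin n × Fin n) → Set
HasLoop = Any (λ (u , v) → u ≡ v)

separates-loop : ∀ {n m} {R : List (Fin n × Fin n)} (f : Fin n → Fin m) → HasLoop R → separates R f ≡ false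
separates-loop f (here {u , _} refl) rewrite dec-true (f u ≟ f u) refl = refl
separates-loop {R = _ ∷ R} f (there loop) rewrite separates-loop {R = R} f loop = ∧-zeroʳ _

homSep : (F : Graph) → List (Fin (V F) × Fin (V F)) → Graph → ℕ
homSep F R G = sumMaps (V F) (V G) (λ f → bit (isHom F G f ∧ separates R f))

hom≡homSep[] : ∀ F G → hom F G ≡ homSep F [] G
hom≡homSep[] F G = trans (hom≡sumMaps F G) (sumMaps-cong (V F) (V G) (λ f → cong bit (sym (∧-identityʳ _))))

homSep-loop : ∀ F {R} G → HasLoop R → homSep F R G ≡ 0
homSep-loop F {R} G loop = trans
  (sumMaps-cong (V F) (V G) (λ f → cong bit (trans (cong (_ ∧_) (separates-loop f loop)) (∧-zeroʳ _))))
  (sumMaps-zero (V F) (V G))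

module _ (F : Graph) {R : List (Fin (V F) × Fin (V F))}
  (non-edges⊆R : ∀ u v → u ≢ v → adj F u v ≡ false → (u , v) ∈ R) (loop-free : ¬ HasLoop R) where

  separates⇒injective : ∀ {G f} → IsHom F G f → separates R f ≡ true → ∀ u v → f u ≡ f v → u ≡ v
  separates⇒injective {G} {f} h sep u v fu≡fv with u ≟ v | adj F u v in a
  ... | yes u≡v | _     = u≡v
  ... | no _    | true  = contradiction (subst (λ z → adj G z (f v) ≡ true) fu≡fv (h u v a))
                                        (λ e → case trans (sym e) (irrefl G (f v)) of λ ())
  ... | no u≢v  | false = contradiction (all-true⁻ _ R sep (non-edges⊆R u v u≢v a))
                                        (λ e → case trans (sym e) (cong not (dec-true (f u ≟ f v) fu≡fv)) of λ ())

  injective⇒separates : ∀ {m} {f : Fin (V F) → Fin m} → (∀ u v → f u ≡ f v → u ≡ v) → separates R f ≡ true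
  injective⇒separates {f = f} inj = all-true⁺ _ R separated
    where
    separated : ∀ {p} → p ∈ R → not (does (f (proj₁ p) ≟ f (proj₂ p))) ≡ true
    separated {u , v} uv∈R with f u ≟ f v
    ... | yes fu≡fv = contradiction (lose uv∈R (inj u v fu≡fv)) loop-free
    ... | no  _     = refl

  homSep≡emb : ∀ G → homSep F R G ≡ emb F G
  homSep≡emb G = trans (sumMaps-cong (V F) (V G) (cong bit ∘ pointwise)) (sym (count-allFuns (V F) (V G) _))
    where
    pointwise : ∀ f → isHom F G f ∧ separates R f ≡ isHom F G f ∧ isInj f
    pointwise f with isHom F G f in e
    ... | false = refl
    ... | true  = ≡true-ext
      (λ sep → injective⇒isInj (separates⇒injective {G} (isHom⇒IsHom F G f e) sep))
      (λ inj → injective⇒separates (isInj⇒injective inj))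

module Image (F : Graph) {k} (μ : Fin (V F) → Fin k) (nonempty′ : 1 ≤ k)
  (fibre-independent : ∀ u v → μ u ≡ μ v → adj F u v ≡ false) where

  adjᵢ : Fin k → Fin k → Bool
  adjᵢ x y = any (λ u → any (λ v → does (μ u ≟ x) ∧ does (μ v ≟ y) ∧ adj F u v) (allFin (V F))) (allFin (V F))

  adjᵢ-intro : ∀ {u v} → adj F u v ≡ true → adjᵢ (μ u) (μ v) ≡ true
  adjᵢ-intro {u} {v} a = any-allFin⁺ _ u (any-allFin⁺ _ v
    (∧-true⁺ (dec-true (μ u ≟ μ u) refl) (∧-true⁺ (dec-true (μ v ≟ μ v) refl) a)))

  adjᵢ-elim : ∀ {x y} → adjᵢ x y ≡ true → ∃[ u ] ∃[ v ] (μ u ≡ x × μ v ≡ y × adj F u v ≡ true)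
  adjᵢ-elim {x} {y} e with u , e₁ ← any-allFin⁻ _ e with v , e₂ ← any-allFin⁻ _ e₁
    with μu≡x , e₃ ← ∧-true⁻ {does (μ u ≟ x)} e₂ with μv≡y , a ← ∧-true⁻ {does (μ v ≟ y)} e₃ =
    u , v , ≟-true⁻ μu≡x , ≟-true⁻ μv≡y , a

  adjᵢ-sym : ∀ x y → adjᵢ x y ≡ true → adjᵢ y x ≡ true
  adjᵢ-sym x y e with u , v , refl , refl , a ← adjᵢ-elim e = adjᵢ-intro (trans (Graph.sym F v u) a)

  adjᵢ-irrefl : ∀ x → adjᵢ x x ≢ true
  adjᵢ-irrefl x e with u , v , μu≡x , μv≡x , a ← adjᵢ-elim e =
    contradiction (trans (sym a) (fibre-independent u v (trans μu≡x (sym μv≡x)))) λ ()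

  image : Graph
  image = record
    { V        = k
    ; nonempty = nonempty′
    ; adj      = adjᵢ
    ; sym      = λ x y → ≡true-ext (adjᵢ-sym x y) (adjᵢ-sym y x)
    ; irrefl   = λ x → ¬-not (adjᵢ-irrefl x)
    }

  isHom-image : ∀ G h → isHom F G (h ∘ μ) ≡ isHom image G h
  isHom-image G h = ≡true-ext
    (λ e → IsHom⇒isHom image G h λ x y a′ → case adjᵢ-elim a′ of λ where
      (u , v , refl , refl , a) → isHom⇒IsHom F G (h ∘ μ) e u v a)
    (λ e → IsHom⇒isHom F G (h ∘ μ) λ u v a → isHom⇒IsHom image G h e (μ u) (μ v) (adjᵢ-intro a))

  image-connected : (∀ x → ∃[ u ] μ u ≡ x) → Connected F → Connected image
  image-connected surjective connected x y
    with u , refl ← surjective x | v , refl ← surjective y = map-walk (connected u v)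
    where
    map-walk : ∀ {u v} → Reachable F u v → Reachable image (μ u) (μ v)
    map-walk here       = here
    map-walk (step a r) = step (adjᵢ-intro a) (map-walk r)

a-or-punchIn : ∀ {n} (a u : Fin (suc n)) → u ≡ a ⊎ ∃[ x ] u ≡ punchIn a x
a-or-punchIn a u with a ≟ u
... | yes a≡u = inj₁ (sym a≡u)
... | no  a≢u = inj₂ (punchOut a≢u , sym (punchIn-punchOut a≢u))

-- F/ab is the image of F under μ, which sends a and b = punchIn a b′ to b′ and punchIn a x to x.
module Contraction {n} (ne : 1 ≤ suc n) (ad : Fin (suc n) → Fin (suc n) → Bool)
  (sy : ∀ u v → ad u v ≡ ad v u) (ir : ∀ v → ad v v ≡ false)
  {a b : Fin (suc n)} (a≢b : a ≢ b) (a≁b : ad a b ≡ false) where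

  F : Graph
  F = record { V = suc n ; nonempty = ne ; adj = ad ; sym = sy ; irrefl = ir }

  b′ : Fin n
  b′ = punchOut a≢b

  μ : Fin (suc n) → Fin n
  μ = insert a b′ id

  μ-a : μ a ≡ b′
  μ-a = insert-at a b′ id

  μ-punchIn : ∀ x → μ (punchIn a x) ≡ x
  μ-punchIn = insert-punchIn a b′ id

  μ-fibre-independent : ∀ u v → μ u ≡ μ v → ad u v ≡ false
  μ-fibre-independent u v μu≡μv with a-or-punchIn a u | a-or-punchIn a v
  ... | inj₁ refl       | inj₁ refl = ir a
  ... | inj₁ refl       | inj₂ (y , refl) with refl ← trans (sym μ-a) (trans μu≡μv (μ-punchIn y)) =
    trans (cong (ad a) (punchIn-punchOut a≢b)) a≁b
  ... | inj₂ (x , refl) | inj₁ refl with refl ← trans (sym (μ-punchIn x)) (trans μu≡μv μ-a) =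
    trans (cong (λ z → ad z a) (punchIn-punchOut a≢b)) (trans (sy b a) a≁b)
  ... | inj₂ (x , refl) | inj₂ (y , refl) with refl ← trans (sym (μ-punchIn x)) (trans μu≡μv (μ-punchIn y)) =
    ir (punchIn a x)

  open Image F μ (>-nonZero⁻¹ n ⦃ nonZeroIndex b′ ⦄) μ-fibre-independent public
    using (isHom-image) renaming (image to F/ab)

  F/ab-connected : Connected F → Connected F/ab
  F/ab-connected = Image.image-connected F μ _ μ-fibre-independent (λ x → punchIn a x , μ-punchIn x)

  -- Every homomorphism either separates a and b, or factors through F/ab.
  homSep-delete-contract : ∀ R G →
    homSep F R G ≡ homSep F ((a , b) ∷ R) G + homSep F/ab (map (Product.map μ μ) R) G
  homSep-delete-contract R G = begin
    sumMaps (suc n) m (λ f → bit (P f))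
      ≡⟨ sumMaps-cong (suc n) m (λ f → bit-split (isHom F G f) (identifies f) (separates R f)) ⟩
    sumMaps (suc n) m (λ f → bit (isHom F G f ∧ separates ((a , b) ∷ R) f) + bit (identifies f) * bit (P f))
      ≡⟨ sumMaps-distrib-+ (suc n) m (λ f → bit (isHom F G f ∧ separates ((a , b) ∷ R) f))
                                     (λ f → bit (identifies f) * bit (P f)) ⟩
    homSep F ((a , b) ∷ R) G + sumMaps (suc n) m (λ f → bit (identifies f) * bit (P f))
      ≡⟨ cong (homSep F ((a , b) ∷ R) G +_) identified ⟩
    homSep F ((a , b) ∷ R) G + homSep F/ab (map (Product.map μ μ) R) G ∎
    where
    open ≡-Reasoning
    m = V G
    P : (Fin (suc n) → Fin m) → Bool
    P f = isHom F G f ∧ separates R f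
    identifies : (Fin (suc n) → Fin m) → Bool
    identifies f = does (f a ≟ f b)
    lift≗∘μ : ∀ (h : Fin n → Fin m) u → insert a (h b′) h u ≡ h (μ u)
    lift≗∘μ h = insert-∘ a b′ id h
    identified : sumMaps (suc n) m (λ f → bit (identifies f) * bit (P f)) ≡ homSep F/ab (map (Product.map μ μ) R) G
    identified = begin
      sumMaps (suc n) m (λ f → bit (identifies f) * bit (P f))
        ≡⟨ sumMaps-cong (suc n) m (λ f →
             cong (λ z → bit (does (f a ≟ f z)) * bit (P f)) (sym (punchIn-punchOut a≢b))) ⟩
      sumMaps (suc n) m (λ f → bit (does (f a ≟ f (punchIn a b′))) * bit (P f))
        ≡⟨ sumMaps-identify n m a b′ (bit ∘ P) ⟩
      sumMaps n m (λ h → bit (P (insert a (h b′) h)))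
        ≡⟨ sumMaps-cong n m (λ h → cong bit (cong₂ _∧_
             (trans (isHom-cong F G (lift≗∘μ h)) (isHom-image G h))
             (trans (separates-cong R (lift≗∘μ h)) (separates-∘ R μ h)))) ⟩
      homSep F/ab (map (Product.map μ μ) R) G ∎

-- Determination by embedding counts

_DeterminedBy_ : (Graph → ℕ) → List Graph → Set
φ DeterminedBy L = ∀ G H → All (λ F → emb F G ≡ emb F H) L → φ G ≡ φ H

EmbDetermined : (Graph → ℕ) → Set
EmbDetermined φ = ∃[ L ] (All Connected L × φ DeterminedBy L)

embDetermined-emb : ∀ {F} → Connected F → EmbDetermined (emb F)
embDetermined-emb {F} connected = F ∷ [] , connected ∷ [] , λ { G H (e ∷ []) → e }

embDetermined-const : ∀ c → EmbDetermined (λ _ → c)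
embDetermined-const c = [] , [] , λ _ _ _ → refl

embDetermined-cong : ∀ {φ ψ} → (∀ G → φ G ≡ ψ G) → EmbDetermined ψ → EmbDetermined φ
embDetermined-cong φ≗ψ (L , connected , det) =
  L , connected , λ G H e → trans (φ≗ψ G) (trans (det G H e) (sym (φ≗ψ H)))

embDetermined-zipWith : ∀ {φ ψ} (_∙_ : ℕ → ℕ → ℕ) →
  EmbDetermined φ → EmbDetermined ψ → EmbDetermined (λ G → φ G ∙ ψ G)
embDetermined-zipWith _∙_ (L₁ , c₁ , d₁) (L₂ , c₂ , d₂) =
  L₁ ++ L₂ , ++⁺ c₁ c₂ , λ G H e → cong₂ _∙_ (d₁ G H (++⁻ˡ L₁ e)) (d₂ G H (++⁻ʳ L₁ e))

NonEdgesCovered : (F : Graph) → (Q R : List (Fin (V F) × Fin (V F))) → Set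
NonEdgesCovered F Q R = ∀ u v → u ≢ v → adj F u v ≡ false → (u , v) ∈ Q ⊎ (u , v) ∈ R

covered-drop : ∀ {F x y Q R} → (x ≢ y → ¬ adj F x y ≡ false) →
  NonEdgesCovered F ((x , y) ∷ Q) R → NonEdgesCovered F Q R
covered-drop not-non-edge covered u v u≢v u≁v with covered u v u≢v u≁v
... | inj₁ (here refl)  = contradiction u≁v (not-non-edge u≢v)
... | inj₁ (there uv∈Q) = inj₁ uv∈Q
... | inj₂ uv∈R         = inj₂ uv∈R

covered-move : ∀ {F x y Q R} → NonEdgesCovered F ((x , y) ∷ Q) R → NonEdgesCovered F Q ((x , y) ∷ R)
covered-move covered u v u≢v u≁v with covered u v u≢v u≁v
... | inj₁ (here refl)  = inj₂ (here refl)
... | inj₁ (there uv∈Q) = inj₁ uv∈Q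
... | inj₂ uv∈R         = inj₂ (there uv∈R)

homSep-embDetermined : ∀ k F → V F ≤ k → Connected F → ∀ R → EmbDetermined (homSep F R)
homSep-embDetermined (suc k) record { V = suc n ; nonempty = ne ; adj = ad ; sym = sy ; irrefl = ir }
                     (s≤s n≤k) connected R =
  reduce (cartesianProduct (allFin (suc n)) (allFin (suc n))) R
         (λ u v _ _ → inj₁ (∈-cartesianProduct⁺ (∈-allFin u) (∈-allFin v)))
  where
  F : Graph
  F = record { V = suc n ; nonempty = ne ; adj = ad ; sym = sy ; irrefl = ir }

  reduce : ∀ Q R → NonEdgesCovered F Q R → EmbDetermined (homSep F R)
  reduce [] R covered with Any.any? (λ (u , v) → u ≟ v) R
  ... | yes loop = embDetermined-cong (λ G → homSep-loop F G loop) (embDetermined-const 0)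
  ... | no  loop-free = embDetermined-cong (homSep≡emb F non-edges⊆R loop-free) (embDetermined-emb connected)
    where
    non-edges⊆R : ∀ u v → u ≢ v → ad u v ≡ false → (u , v) ∈ R
    non-edges⊆R u v u≢v u≁v with inj₂ uv∈R ← covered u v u≢v u≁v = uv∈R
  reduce ((x , y) ∷ Q) R covered with x ≟ y | ad x y in x~y
  ... | yes x≡y | _     = reduce Q R (covered-drop {F} (λ x≢y _ → x≢y x≡y) covered)
  ... | no _    | true  = reduce Q R (covered-drop {F} (λ _ x≁y → case trans (sym x~y) x≁y of λ ()) covered)
  ... | no x≢y  | false = embDetermined-cong (homSep-delete-contract R) (embDetermined-zipWith _+_
        (reduce Q ((x , y) ∷ R) (covered-move {F} covered))
        (homSep-embDetermined k F/ab n≤k (F/ab-connected connected) (map (Product.map μ μ) R)))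
    where
    open Contraction ne ad sy ir x≢y x~y using (homSep-delete-contract; F/ab; F/ab-connected; μ)

hom-embDetermined : ∀ F → EmbDetermined (hom F)
hom-embDetermined F = go (V F) F ≤-refl
  where
  go : ∀ k F → V F ≤ k → EmbDetermined (hom F)
  go zero    F V≤0   = contradiction (≤-trans (nonempty F) V≤0) λ ()
  go (suc k) F V≤1+k with connected-or-splits F
  ... | inj₁ connected = embDetermined-cong (hom≡homSep[] F) (homSep-embDetermined (suc k) F V≤1+k connected [])
  ... | inj₂ (p , closed , ne , ne′) = embDetermined-cong (hom-split {F} {p} closed ne ne′)
        (embDetermined-zipWith _*_ (go k (induced F p ne) (≤-pred (≤-trans ∣p∣<V V≤1+k)))
                                   (go k (induced F (∁ p) ne′) (≤-pred (≤-trans ∣∁p∣<V V≤1+k))))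
    where
    ∣p∣<V : ∣ p ∣ < V F
    ∣p∣<V = subst (∣ p ∣ <_) (∣p∣+∣∁p∣≡n p) (m<m+n ∣ p ∣ ne′)
    ∣∁p∣<V : ∣ ∁ p ∣ < V F
    ∣∁p∣<V = subst (∣ ∁ p ∣ <_) (∣p∣+∣∁p∣≡n p) (m<n+m ∣ ∁ p ∣ ne)

homs-determined : ∀ K → ∃[ L ] (All Connected L ×
  ∀ G H → All (λ F′ → emb F′ G ≡ emb F′ H) L → All (λ F → hom F G ≡ hom F H) K)
homs-determined []      = [] , [] , λ _ _ _ → []
homs-determined (F ∷ K) with L₁ , c₁ , d₁ ← hom-embDetermined F | L₂ , c₂ , d₂ ← homs-determined K =
  L₁ ++ L₂ , ++⁺ c₁ c₂ , λ G H e → d₁ G H (++⁻ˡ L₁ e) ∷ d₂ G H (++⁻ʳ L₁ e)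

map-cong-toList : ∀ {k} {f g : Graph → ℕ} (Fs : Vec Graph k) →
  All (λ F → f F ≡ g F) (Vec.toList Fs) → Vec.map f Fs ≡ Vec.map g Fs
map-cong-toList []       []       = refl
map-cong-toList (F ∷ Fs) (e ∷ es) = cong₂ _∷_ e (map-cong-toList Fs es)

lemma5p1 : (C : Graph → Set) → IsoClosed C →
    (∀ (K′ : List Graph) → All Connected K′ →
    ∃[ G ] ∃[ H ] (C G × ¬ C H × All (λ F′ → emb F′ G ≡ emb F′ H) K′)) →
    (∀ (K : List Graph) →
    ∃[ G ] ∃[ H ] (C G × ¬ C H × All (λ F → hom F G ≡ hom F H) K))
    × ¬ HasHomAlgorithm C
lemma5p1 C _ emb-indistinguishable = hom-indistinguishable , no-hom-algorithm
  where
  hom-indistinguishable : ∀ K → ∃[ G ] ∃[ H ] (C G × ¬ C H × All (λ F → hom F G ≡ hom F H) K)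
  hom-indistinguishable K
    with L , connected , determined ← homs-determined K
    with G , H , G∈C , H∉C , same-embs ← emb-indistinguishable L connected =
    G , H , G∈C , H∉C , determined G H same-embs

  no-hom-algorithm : ¬ HasHomAlgorithm C
  no-hom-algorithm (k , _ , Fs , X , decides)
    with G , H , G∈C , H∉C , same-homs ← hom-indistinguishable (Vec.toList Fs) =
    H∉C (from (decides H) (subst X (map-cong-toList Fs same-homs) (to (decides G) G∈C)))
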